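{- If $Y$ is a graph for which $|\mathrm{src}(Y)|=1$, then $Y$ is connected.
   Context: A multigraph may have multiple edges but no loops; a graph has neither loops nor multiple edges. Multigraphs from which generalized truncations are formed are assumed to have no isolated vertices. Generalized truncation: let $X$ be a multigraph. Take a matching $M_0$ with $|M_0|=|E(X)|$ (on $2|E(X)|$ new vertices) and a bijection $F:E(X)\to M_0$; for each edge $e$ of $X$ with ends $u,v$, label one end of $F(e)$ by $u$ and the other by $v$. For $v\in V(X)$, the cluster $\mathrm{cl}(v)$ is the set of vertices labelled $v$; insert an arbitrary graph $\mathrm{con}(v)$ on $\mathrm{cl}(v)$. The graph $F(M_0)\cup\bigcup_v\mathrm{con}(v)$, and any graph isomorphic to it, is a generalized truncation of $X$. For a graph $Y$, the source $\mathrm{src}(Y)$ is the set of multigraphs $X$ (without loops, considered up to isomorphism) such that $Y$ is a generalized truncation of $X$. -}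

module Defs where

open import Data.Nat using (ℕ)
open import Data.Fin using (Fin; _≟_)
open import Data.Bool using (Bool; true; false; T; _∧_; _∨_; _xor_)
open import Data.Product using (Σ; ∃; _×_; _,_; proj₁; proj₂)
open import Data.Sum using (_⊎_)
open import Relation.Nullary using (¬_)
open import Relation.Nullary.Decidable using (⌊_⌋)
open import Relation.Binary.PropositionalEquality using (_≡_; _≢_)
open import Relation.Binary.Construct.Closure.ReflexiveTransitive using (Star)
open import Function.Bundles using (_↔_; Inverse)

record Graph (V : Set) : Set where
  field
    adj    : V → V → Bool
    sym    : ∀ u v → adj u v ≡ adj v u
    irrefl : ∀ v → adj v v ≡ false
open Graph public

Edge : ∀ {V} → Graph V → V → V → Set
Edge G u v = T (adj G u v)

Connected : ∀ {n} → Graph (Fin n) → Set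
Connected {n} G = ∀ (u v : Fin n) → Star (Edge G) u v

record Multigraph : Set where
  field
    nV : ℕ
    nE : ℕ
    src : Fin nE → Fin nV
    tgt : Fin nE → Fin nV
    loopless : ∀ e → src e ≢ tgt e
    noIsolated : ∀ v → ∃ λ e → (src e ≡ v) ⊎ (tgt e ≡ v)
open Multigraph public

record _≅ᴹ_ (X X' : Multigraph) : Set where
  field
    vmap : Fin (nV X) ↔ Fin (nV X')
    emap : Fin (nE X) ↔ Fin (nE X')
    ends : ∀ e →
      (src X' (Inverse.to emap e) ≡ Inverse.to vmap (src X e) ×
       tgt X' (Inverse.to emap e) ≡ Inverse.to vmap (tgt X e))
      ⊎
      (src X' (Inverse.to emap e) ≡ Inverse.to vmap (tgt X e) ×
       tgt X' (Inverse.to emap e) ≡ Inverse.to vmap (src X e))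

-- Vertices of the matching M₀: the two ends of F(e) for each edge e of X.
TVert : Multigraph → Set
TVert X = Fin (nE X) × Bool

label : (X : Multigraph) → TVert X → Fin (nV X)
label X (e , false) = src X e
label X (e , true)  = tgt X e

-- The generalized truncation built from X with the graphs con(v) given jointly
-- by a graph `con` on TVert X, of which only edges inside clusters are used:
-- F(M₀) ∪ ⋃_v con(v).
truncAdj : (X : Multigraph) → Graph (TVert X) → TVert X → TVert X → Bool
truncAdj X con (e , b) (e' , b') =
  (⌊ e ≟ e' ⌋ ∧ (b xor b'))
  ∨ (⌊ label X (e , b) ≟ label X (e' , b') ⌋ ∧ adj con (e , b) (e' , b'))

IsGenTrunc : ∀ {n} → Graph (Fin n) → Multigraph → Set
IsGenTrunc {n} Y X =
  Σ (Graph (TVert X)) λ con →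
  Σ (Fin n ↔ TVert X) λ φ →
    ∀ u v → adj Y u v ≡ truncAdj X con (Inverse.to φ u) (Inverse.to φ v)

-- |src(Y)| = 1: some multigraph is in src(Y), and every member of src(Y)
-- is isomorphic to it.
UniqueSource : ∀ {n} → Graph (Fin n) → Set
UniqueSource Y =
  Σ Multigraph λ X → IsGenTrunc Y X × (∀ X' → IsGenTrunc Y X' → X' ≅ᴹ X)

-- If Y is disconnected, a closed set S of vertices (a union of components) cuts Y.
-- Either S splits some cluster, and splitting that cluster along S gives a source
-- with one vertex more, or S is a union of clusters, and merging a cluster inside S
-- with one outside gives a source with one vertex fewer: no edge of X joins them,
-- since every matching edge stays on one side of the cut. Either way src(Y) contains
-- multigraphs of different orders.
module Submission where

open import Level using (0ℓ)
open import Data.Nat using (ℕ; zero; suc; pred; _≤_; z≤n; s≤s)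
open import Data.Nat.Properties using (≤-trans; 1+n≢n; 1+n≰n)
open import Data.Fin using (Fin; zero; suc; _≟_; punchIn; punchOut)
open import Data.Fin.Properties
  using (any?; suc-injective; punchOut-injective; punchOut-cong; punchOut-punchIn;
         punchInᵢ≢i; cantor-schröder-bernstein)
open import Data.Fin.Subset using (Subset; _∈_; _⊂_; ∣_∣)
open import Data.Fin.Subset.Properties using (p⊂q⇒∣p∣<∣q∣; ∣p∣≤n)
open import Data.Vec using (tabulate)
open import Data.Vec.Properties using (lookup⇒[]=; []=⇒lookup; lookup∘tabulate)
open import Data.Bool using (true; false; not; T; _∧_; _∨_; _xor_)
open import Data.Bool.Properties using (T-∧; T-∨; ∧-zeroʳ)
open import Data.Product using (Σ; ∃; _×_; _,_; proj₁; proj₂)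
open import Data.Sum using (_⊎_; inj₁; inj₂)
open import Data.Empty using (⊥-elim)
open import Function using (_∘_)
open import Function.Bundles using (_↔_; Inverse; Injection; Equivalence)
open import Function.Properties.Inverse using (↔⇒↣; ↔-sym)
open import Relation.Nullary using (¬_; Dec; yes; no; does; contradiction)
open import Relation.Nullary.Decidable
  using (⌊_⌋; fromWitness; toWitness; dec-true; map′; T?; _×-dec_; _⊎-dec_; ¬?)
open import Relation.Unary using (Pred; Decidable)
open import Relation.Binary.Core using (Rel)
open import Relation.Binary.Definitions using (_Respects_)
import Relation.Binary.Definitions as B
open import Relation.Binary.PropositionalEquality
  using (_≡_; _≢_; refl; sym; trans; cong; cong₂; subst; module ≡-Reasoning)
open import Relation.Binary.Construct.Closure.ReflexiveTransitive using (Star; ε; _◅_; _◅◅_)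
open import Defs hiding (sym)

open Inverse using (to; from; strictlyInverseˡ; strictlyInverseʳ)
open Equivalence using () renaming (to to ⇒; from to ⇐)

Fin-↔⇒≡ : ∀ {m n} → Fin m ↔ Fin n → m ≡ n
Fin-↔⇒≡ f = cantor-schröder-bernstein
  (Injection.injective (↔⇒↣ f)) (Injection.injective (↔⇒↣ (↔-sym f)))

≅ᴹ⇒nV≡ : ∀ {X X'} → X ≅ᴹ X' → nV X ≡ nV X'
≅ᴹ⇒nV≡ iso = Fin-↔⇒≡ (_≅ᴹ_.vmap iso)

any?-↔ : ∀ {n} {A : Set} {P : Pred A 0ℓ} → Fin n ↔ A → Decidable P → Dec (∃ P)
any?-↔ {P = P} φ P? =
  map′ (λ (i , p) → to φ i , p)
       (λ (x , p) → from φ x , subst P (sym (strictlyInverseˡ φ x)) p)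
       (any? (P? ∘ to φ))

Star-respects : ∀ {a r p} {A : Set a} {R : Rel A r} {P : Pred A p} →
                P Respects R → P Respects Star R
Star-respects resp ε        p = p
Star-respects resp (r ◅ rs) p = Star-respects resp rs (resp r p)

Star-from-respects : ∀ {a r} {A : Set a} {R : Rel A r} u → Star R u Respects R
Star-from-respects u r u⇝x = u⇝x ◅◅ r ◅ ε

module _ {n : ℕ} {P : Pred (Fin n) 0ℓ} (P? : Decidable P) where

  toSubset : Subset n
  toSubset = tabulate (does ∘ P?)

  ∈-toSubset⁺ : ∀ {x} → P x → x ∈ toSubset
  ∈-toSubset⁺ {x} p = lookup⇒[]= x _ (trans (lookup∘tabulate _ x) (dec-true (P? x) p))

  ∈-toSubset⁻ : ∀ {x} → x ∈ toSubset → P x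
  ∈-toSubset⁻ {x} x∈ with P? x | trans (sym (lookup∘tabulate (does ∘ P?) x)) ([]=⇒lookup x∈)
  ... | yes p | _ = p
  ... | no _  | ()

module Reachability {n : ℕ} {R : Rel (Fin n) 0ℓ} (R? : B.Decidable R) (u : Fin n) where

  Within : ℕ → Pred (Fin n) 0ℓ
  Within zero    x = u ≡ x
  Within (suc k) x = Within k x ⊎ ∃ λ y → Within k y × R y x

  within? : ∀ k → Decidable (Within k)
  within? zero    x = u ≟ x
  within? (suc k) x = within? k x ⊎-dec any? (λ y → within? k y ×-dec R? y x)

  Within⇒Star : ∀ k {x} → Within k x → Star R u x
  Within⇒Star zero    refl                = ε
  Within⇒Star (suc k) (inj₁ w)            = Within⇒Star k w
  Within⇒Star (suc k) (inj₂ (y , w , r)) = Within⇒Star k w ◅◅ r ◅ ε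

  u-within : ∀ k → Within k u
  u-within zero    = refl
  u-within (suc k) = inj₁ (u-within k)

  ball : ℕ → Subset n
  ball k = toSubset (within? k)

  Within-suc-respects : ∀ k → Within k Respects R → Within (suc k) Respects R
  Within-suc-respects k resp r (inj₁ w)            = inj₁ (resp r w)
  Within-suc-respects k resp r (inj₂ (y , w , r')) = inj₁ (resp r (resp r' w))

  -- Until the ball is closed, every round adds a vertex to it.
  respects-or-large : ∀ k → Within k Respects R ⊎ k ≤ ∣ ball k ∣
  respects-or-large zero = inj₂ z≤n
  respects-or-large (suc k) with respects-or-large k
  ... | inj₁ resp  = inj₁ (Within-suc-respects k resp)
  ... | inj₂ large with any? (λ x → within? (suc k) x ×-dec ¬? (within? k x))
  ...   | yes (x , new , old) = inj₂ (≤-trans (s≤s large) (p⊂q⇒∣p∣<∣q∣ ball-grows))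
    where
    ball-grows : ball k ⊂ ball (suc k)
    ball-grows = (λ y∈ → ∈-toSubset⁺ (within? (suc k)) (inj₁ (∈-toSubset⁻ (within? k) y∈)))
               , x , ∈-toSubset⁺ (within? (suc k)) new , old ∘ ∈-toSubset⁻ (within? k)
  ...   | no nothing-new = inj₁ (Within-suc-respects k resp)
    where
    resp : Within k Respects R
    resp {x} {y} r w with within? k y
    ... | yes w' = w'
    ... | no ¬w' = contradiction (y , inj₂ (x , w , r) , ¬w') nothing-new

  Within-respects : Within (suc n) Respects R
  Within-respects with respects-or-large (suc n)
  ... | inj₁ resp  = resp
  ... | inj₂ large = contradiction (≤-trans large (∣p∣≤n (ball (suc n)))) 1+n≰n

  reachable? : Decidable (Star R u)
  reachable? x = map′ (Within⇒Star (suc n))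
                      (λ u⇝x → Star-respects Within-respects u⇝x (u-within (suc n)))
                      (within? (suc n) x)

Star-decidable : ∀ {n} {R : Rel (Fin n) 0ℓ} → B.Decidable R → B.Decidable (Star R)
Star-decidable R? u = Reachability.reachable? R? u

merge : ∀ {N} (a b : Fin N) → a ≢ b → Fin N → Fin (pred N)
merge {suc _} a b a≢b l with b ≟ l
... | yes _   = punchOut {i = b} {j = a} (a≢b ∘ sym)
... | no b≢l = punchOut b≢l

merge-surjective : ∀ {N} {a b : Fin N} (a≢b : a ≢ b) j → ∃ λ l → merge a b a≢b l ≡ j
merge-surjective {suc _} {a} {b} a≢b j = punchIn b j , merge-punchIn
  where
  merge-punchIn : merge a b a≢b (punchIn b j) ≡ j
  merge-punchIn with b ≟ punchIn b j
  ... | yes b≡ = contradiction (sym b≡) (punchInᵢ≢i b j)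
  ... | no _   = trans (punchOut-cong b refl) (punchOut-punchIn b)

merge-fibres : ∀ {N} {a b : Fin N} (a≢b : a ≢ b) {l l'} → merge a b a≢b l ≡ merge a b a≢b l' →
               l ≡ l' ⊎ (l ≡ a × l' ≡ b) ⊎ (l ≡ b × l' ≡ a)
merge-fibres {suc _} {a} {b} a≢b {l} {l'} eq with b ≟ l | b ≟ l'
... | yes b≡l | yes b≡l' = inj₁ (trans (sym b≡l) b≡l')
... | yes b≡l | no b≢l'  = inj₂ (inj₂ (sym b≡l , sym (punchOut-injective (a≢b ∘ sym) b≢l' eq)))
... | no b≢l  | yes b≡l' = inj₂ (inj₁ (punchOut-injective b≢l (a≢b ∘ sym) eq , sym b≡l'))
... | no b≢l  | no b≢l'  = inj₁ (punchOut-injective b≢l b≢l' eq)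

pred≢ : ∀ {N} → Fin N → pred N ≢ N
pred≢ {suc _} _ = 1+n≢n ∘ sym

∨-∧-implied-guard : ∀ a b d → (T b → T d) → a ∨ (d ∧ (a ∨ b)) ≡ a ∨ b
∨-∧-implied-guard true  b     d     _   = refl
∨-∧-implied-guard false false d     _   = ∧-zeroʳ d
∨-∧-implied-guard false true  true  _   = refl
∨-∧-implied-guard false true  false b⇒d = ⊥-elim (b⇒d _)

transport : ∀ {A B : Set} → A ↔ B → Graph A → Graph B
transport φ G = record
  { adj    = λ x y → adj G (from φ x) (from φ y)
  ; sym    = λ x y → Graph.sym G (from φ x) (from φ y)
  ; irrefl = λ x → irrefl G (from φ x)
  }

label-surjective : ∀ X w → ∃ λ t → label X t ≡ w
label-surjective X w with noIsolated X w
... | e , inj₁ src≡w = (e , false) , src≡w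
... | e , inj₂ tgt≡w = (e , true)  , tgt≡w

matching-edge : ∀ X con e b → T (truncAdj X con (e , b) (e , not b))
matching-edge X con e b =
  ⇐ (T-∨ {⌊ e ≟ e ⌋ ∧ (b xor not b)}) (inj₁ (⇐ T-∧ (fromWitness refl , xor-not b)))
  where
  xor-not : ∀ b → T (b xor not b)
  xor-not true  = _
  xor-not false = _

cluster-edge : ∀ X con {t t'} → label X t ≡ label X t' → T (adj con t t') →
               T (truncAdj X con t t')
cluster-edge X con {e , b} {e' , b'} same c =
  ⇐ (T-∨ {⌊ e ≟ e' ⌋ ∧ (b xor b')}) (inj₂ (⇐ T-∧ (fromWitness same , c)))

record Regrouping (X : Multigraph) (con : Graph (TVert X)) (m : ℕ) : Set where
  field
    cluster      : TVert X → Fin m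
    surjective   : ∀ w → ∃ λ t → cluster t ≡ w
    separates    : ∀ e → cluster (e , false) ≢ cluster (e , true)
    con-internal : ∀ t t' → label X t ≡ label X t' → T (adj con t t') → cluster t ≡ cluster t'
open Regrouping

regrouped : ∀ {X con m} → Regrouping X con m → Multigraph
regrouped {X} {m = m} R = record
  { nV = m ; nE = nE X
  ; src = λ e → cluster R (e , false) ; tgt = λ e → cluster R (e , true)
  ; loopless = separates R ; noIsolated = end-at ∘ surjective R }
  where
  end-at : ∀ {w} → ∃ (λ t → cluster R t ≡ w) → _
  end-at ((e , false) , eq) = e , inj₁ eq
  end-at ((e , true)  , eq) = e , inj₂ eq

label-regrouped : ∀ {X con m} (R : Regrouping X con m) t → label (regrouped R) t ≡ cluster R t
label-regrouped R (_ , false) = refl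
label-regrouped R (_ , true)  = refl

module Truncation {n : ℕ} (Y : Graph (Fin n)) (X : Multigraph) (trunc : IsGenTrunc Y X) where

  con : Graph (TVert X)
  con = proj₁ trunc

  φ : Fin n ↔ TVert X
  φ = proj₁ (proj₂ trunc)

  h : ∀ u v → adj Y u v ≡ truncAdj X con (to φ u) (to φ v)
  h = proj₂ (proj₂ trunc)

  adj-transport : ∀ t t' → adj (transport φ Y) t t' ≡ truncAdj X con t t'
  adj-transport t t' =
    trans (h _ _) (cong₂ (truncAdj X con) (strictlyInverseˡ φ t) (strictlyInverseˡ φ t'))

  -- The new graphs con(v) are the subgraphs of Y induced on the new clusters.
  regroup : ∀ {m} (R : Regrouping X con m) → IsGenTrunc Y (regrouped R)
  regroup R = transport φ Y , φ , λ u v → trans (h u v) (sym (same-adjacency (to φ u) (to φ v)))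
    where
    open ≡-Reasoning
    X' = regrouped R

    still-clustered : ∀ t t' → T (⌊ label X t ≟ label X t' ⌋ ∧ adj con t t') →
                      T ⌊ label X' t ≟ label X' t' ⌋
    still-clustered t t' p with ⇒ T-∧ p
    ... | same , c = fromWitness (trans (label-regrouped R t)
                       (trans (con-internal R t t' (toWitness same) c) (sym (label-regrouped R t'))))

    same-adjacency : ∀ t t' → truncAdj X' (transport φ Y) t t' ≡ truncAdj X con t t'
    same-adjacency t@(e , b) t'@(e' , b') = begin
      match ∨ (⌊ label X' t ≟ label X' t' ⌋ ∧ adj (transport φ Y) t t')
        ≡⟨ cong (λ c → match ∨ (⌊ label X' t ≟ label X' t' ⌋ ∧ c)) (adj-transport t t') ⟩
      match ∨ (⌊ label X' t ≟ label X' t' ⌋ ∧ truncAdj X con t t')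
        ≡⟨ ∨-∧-implied-guard match _ _ (still-clustered t t') ⟩
      truncAdj X con t t' ∎
      where match = ⌊ e ≟ e' ⌋ ∧ (b xor b')

  module Cut {S : Pred (Fin n) 0ℓ} (S? : Decidable S) (S-closed : S Respects Edge Y) where

    Sᵗ : Pred (TVert X) 0ℓ
    Sᵗ t = S (from φ t)

    Sᵗ-closed : ∀ {t t'} → T (truncAdj X con t t') → Sᵗ t → Sᵗ t'
    Sᵗ-closed {t} {t'} p = S-closed (subst T (sym (adj-transport t t')) p)

    matched-forward : ∀ e → Sᵗ (e , false) → Sᵗ (e , true)
    matched-forward e = Sᵗ-closed (matching-edge X con e false)

    matched-backward : ∀ e → Sᵗ (e , true) → Sᵗ (e , false)
    matched-backward e = Sᵗ-closed (matching-edge X con e true)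

    Sᵗ-con : ∀ {t t'} → label X t ≡ label X t' → T (adj con t t') → Sᵗ t → Sᵗ t'
    Sᵗ-con same c = Sᵗ-closed (cluster-edge X con same c)

    split : ∀ {t₁ t₂} → label X t₁ ≡ label X t₂ → Sᵗ t₁ → ¬ Sᵗ t₂ →
            Regrouping X con (suc (nV X))
    split {t₁} {t₂} same in₁ out₂ = record
      { cluster = split-cluster ; surjective = surj
      ; separates = λ e → loopless X e ∘ refines ; con-internal = internal }
      where
      w₀ = label X t₁

      InPart : Pred (TVert X) 0ℓ
      InPart t = label X t ≡ w₀ × Sᵗ t

      split-cluster : TVert X → Fin (suc (nV X))
      split-cluster t with label X t ≟ w₀ ×-dec S? (from φ t)
      ... | yes _ = zero
      ... | no _  = suc (label X t)

      inside : ∀ {t} → InPart t → split-cluster t ≡ zero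
      inside {t} p with label X t ≟ w₀ ×-dec S? (from φ t)
      ... | yes _ = refl
      ... | no ¬p = contradiction p ¬p

      outside : ∀ {t} → ¬ InPart t → split-cluster t ≡ suc (label X t)
      outside {t} ¬p with label X t ≟ w₀ ×-dec S? (from φ t)
      ... | yes p = contradiction p ¬p
      ... | no _  = refl

      refines : ∀ {t t'} → split-cluster t ≡ split-cluster t' → label X t ≡ label X t'
      refines {t} {t'} eq with label X t ≟ w₀ ×-dec S? (from φ t)
                             | label X t' ≟ w₀ ×-dec S? (from φ t')
      ... | yes (p , _) | yes (p' , _) = trans p (sym p')
      ... | no _        | no _         = suc-injective eq

      surj : ∀ w → ∃ λ t → split-cluster t ≡ w
      surj zero = t₁ , inside (refl , in₁)
      surj (suc w) with w ≟ w₀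
      ... | yes refl = t₂ , trans (outside (out₂ ∘ proj₂)) (cong suc (sym same))
      ... | no w≢w₀ with label-surjective X w
      ...   | t , refl = t , outside (w≢w₀ ∘ proj₁)

      internal : ∀ t t' → label X t ≡ label X t' → T (adj con t t') →
                 split-cluster t ≡ split-cluster t'
      internal t t' same' c with label X t ≟ w₀ ×-dec S? (from φ t)
                               | label X t' ≟ w₀ ×-dec S? (from φ t')
      ... | yes _       | yes _       = refl
      ... | no _        | no _        = cong suc same'
      ... | yes (p , s) | no ¬p'      = contradiction (trans (sym same') p , Sᵗ-con same' c s) ¬p'
      ... | no ¬p       | yes (p' , s') =
        contradiction (trans same' p' , Sᵗ-con (sym same') (subst T (Graph.sym con t t') c) s') ¬p

    merging : (∀ {t t'} → label X t ≡ label X t' → Sᵗ t → Sᵗ t') →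
              ∀ {tᵢ tₒ} → Sᵗ tᵢ → ¬ Sᵗ tₒ → Regrouping X con (pred (nV X))
    merging unsplit {tᵢ} {tₒ} inᵢ outₒ = record
      { cluster = merge-cluster ; surjective = surj
      ; separates = sep ; con-internal = λ _ _ same _ → cong (merge a b a≢b) same }
      where
      a = label X tᵢ
      b = label X tₒ

      at-a : ∀ {t} → label X t ≡ a → Sᵗ t
      at-a p = unsplit (sym p) inᵢ

      at-b : ∀ {t} → label X t ≡ b → ¬ Sᵗ t
      at-b p s = outₒ (unsplit p s)

      a≢b : a ≢ b
      a≢b a≡b = at-b {tₒ} refl (at-a (sym a≡b))

      merge-cluster : TVert X → Fin (pred (nV X))
      merge-cluster t = merge a b a≢b (label X t)

      surj : ∀ j → ∃ λ t → merge-cluster t ≡ j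
      surj j with merge-surjective a≢b j
      ... | l , eq with label-surjective X l
      ...   | t , refl = t , eq

      sep : ∀ e → merge-cluster (e , false) ≢ merge-cluster (e , true)
      sep e eq with merge-fibres a≢b eq
      ... | inj₁ same             = loopless X e same
      ... | inj₂ (inj₁ (p , q))  = at-b q (matched-forward e (at-a p))
      ... | inj₂ (inj₂ (p , q))  = at-b p (matched-backward e (at-a q))

    other-order : ∀ {u v} → S u → ¬ S v →
                  Σ Multigraph λ X' → IsGenTrunc Y X' × nV X' ≢ nV X
    other-order {u} {v} u∈S v∉S with any?-↔ φ (λ t → any?-↔ φ (λ t' →
      (label X t ≟ label X t') ×-dec (S? (from φ t) ×-dec ¬? (S? (from φ t')))))
    ... | yes (t , t' , same , s , ¬s') = regrouped R , regroup R , 1+n≢n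
      where R = split same s ¬s'
    ... | no unsplit = regrouped R , regroup R , pred≢ (label X (to φ u))
      where
      unsplit′ : ∀ {t t'} → label X t ≡ label X t' → Sᵗ t → Sᵗ t'
      unsplit′ {t} {t'} same s with S? (from φ t')
      ... | yes s' = s'
      ... | no ¬s' = contradiction (t , t' , same , s , ¬s') unsplit

      R = merging unsplit′ (subst S (sym (strictlyInverseʳ φ u)) u∈S)
                           (v∉S ∘ subst S (strictlyInverseʳ φ v))

reachable? : ∀ {n} (G : Graph (Fin n)) → B.Decidable (Star (Edge G))
reachable? G = Star-decidable (λ x y → T? (adj G x y))

lemma2p6 : ∀ {n : ℕ} (Y : Graph (Fin n)) → UniqueSource Y → Connected Y
lemma2p6 Y (X , trunc , unique) u v with reachable? Y u v
... | yes u⇝v = u⇝v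
... | no u↛v
  with Truncation.Cut.other-order Y X trunc (reachable? Y u) (Star-from-respects u) ε u↛v
...   | X' , X'-source , order≢ = contradiction (≅ᴹ⇒nV≡ (unique X' X'-source)) order≢
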